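{- Let $S$ be a numerical monoid, let $a\in S$ with $a\ne0$, and let $A=\{0,a\}$. Then $\omega\big(\mathcal P_{\mathrm{fin}}(S),A\big)=\omega\big(\mathcal P_{\mathrm{fin},0}(S),A\big)=\infty$.
   Context: A numerical monoid is an additive submonoid $S\subset\mathbb N_0$ with $\gcd(S)=1$. $\mathcal P_{\mathrm{fin}}(S)$ is the monoid of finite nonempty subsets of $S$ under set addition $X+Y=\{x+y\colon x\in X,y\in Y\}$, and $\mathcal P_{\mathrm{fin},0}(S)$ is its submonoid of sets containing $0$. In a monoid $H$, $X$ divides $Y$ if $Y=X+Z$ for some $Z\in H$. For $X\in H$, $\omega(H,X)$ is the smallest $N\in\mathbb N_0\cup\{\infty\}$ such that for all $n\in\mathbb N$ and $X_1,\dots,X_n\in H$, if $X$ divides $X_1+\dots+X_n$, then there is $\Omega\subset[1,n]$ with $|\Omega|\le N$ such that $X$ divides $\sum_{\lambda\in\Omega}X_\lambda$. -}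

module Defs where

open import Data.Nat using (ℕ; zero; suc; _+_; _≤_)
open import Data.Nat.Divisibility using (_∣_)
open import Data.List using (List; []; _∷_; map; concatMap)
open import Data.List.Membership.Propositional using (_∈_)
open import Data.List.Relation.Unary.All using (All)
open import Data.Fin using (Fin)
open import Data.Fin.Subset using (Subset; ∣_∣)
open import Data.Vec using (_∷_)
open import Data.Bool using (true; false)
open import Data.Product using (Σ; _×_)
open import Relation.Nullary using (¬_)
open import Relation.Binary.PropositionalEquality using (_≡_)
open import Function.Bundles using (_⇔_)

record IsNumericalMonoid (S : ℕ → Set) : Set₁ where
  field
    zero∈ : S 0
    +-closed : ∀ {x y} → S x → S y → S (x + y)
    gcd≡1 : ∀ d → (∀ s → S s → d ∣ s) → d ≡ 1

-- Finite subsets of ℕ are represented by lists; equality of the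
-- represented sets is extensional membership equality.
_≋_ : List ℕ → List ℕ → Set
X ≋ Y = ∀ x → (x ∈ X) ⇔ (x ∈ Y)

_⊕_ : List ℕ → List ℕ → List ℕ
X ⊕ Y = concatMap (λ x → map (x +_) Y) X

Pfin : (ℕ → Set) → List ℕ → Set
Pfin S X = Σ ℕ (λ x → x ∈ X) × All S X

Pfin0 : (ℕ → Set) → List ℕ → Set
Pfin0 S X = (0 ∈ X) × All S X

Divides : (List ℕ → Set) → List ℕ → List ℕ → Set
Divides H X Y = Σ (List ℕ) (λ Z → H Z × (Y ≋ (X ⊕ Z)))

sumFam : ∀ {n} → (Fin n → List ℕ) → List ℕ
sumFam {zero} X = 0 ∷ []
sumFam {suc n} X = X Fin.zero ⊕ sumFam (λ i → X (Fin.suc i))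

sumSub : ∀ {n} → Subset n → (Fin n → List ℕ) → List ℕ
sumSub {zero} _ X = 0 ∷ []
sumSub {suc n} (true ∷ Ω) X = X Fin.zero ⊕ sumSub Ω (λ i → X (Fin.suc i))
sumSub {suc n} (false ∷ Ω) X = sumSub Ω (λ i → X (Fin.suc i))

OmegaBound : (List ℕ → Set) → List ℕ → ℕ → Set
OmegaBound H A N =
  ∀ n (X : Fin n → List ℕ) → (∀ i → H (X i)) →
  Divides H A (sumFam X) →
  Σ (Subset n) (λ Ω → (∣ Ω ∣ ≤ N) × Divides H A (sumSub Ω X))

OmegaInfinite : (List ℕ → Set) → List ℕ → Set
OmegaInfinite H A = ∀ N → ¬ OmegaBound H A N

-- Work in units of a.  With X = {0,1,3}, the n-fold sum nX is [0,3n] ∖ {3n−1}, and with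
-- W = {0, 3k−1, 3k} the sum W + kX is the whole interval [0,6k] = {0,1} + [0,6k−1].
-- Every proper subfamily of (W, X, …, X) (k copies of X) sums to jX or W + jX with j < k,
-- in which 3j is isolated: neither 3j − 1 nor 3j + 1 lies in the sum.  An isolated point y
-- of Y rules out Y = {0,1} + Z, since y or y − 1 would have to lie in Z.  Taking k = N + 1
-- shows ω > N for every N.
module Submission where

open import Defs
open import Data.Nat
open import Data.Nat.Properties
open import Data.List using (List; []; _∷_; _++_; map; upTo)
open import Data.List.Properties using (map-++; map-∘; map-cong; map-id)
open import Data.List.Membership.Propositional using (_∈_; _∉_; find)
open import Data.List.Membership.Propositional.Properties
  using (∈-concatMap⁺; ∈-concatMap⁻; ∈-map⁺; ∈-map⁻; ∈-++⁺ˡ; ∈-++⁻; ∈-upTo⁺; ∈-upTo⁻)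
open import Data.List.Relation.Binary.Subset.Propositional.Properties using () renaming (map⁺ to map-⊆)
open import Data.List.Relation.Unary.Any using (here; there)
import Data.List.Relation.Unary.Any as Any
import Data.List.Relation.Unary.All as All
import Data.List.Relation.Unary.All.Properties as All
open import Data.Product using (∃; ∃₂; _×_; _,_; proj₁; proj₂)
open import Data.Sum using (inj₁; inj₂)
open import Data.Vec using (_∷_; [])
open import Data.Bool using (true; false)
open import Data.Fin using (Fin)
open import Data.Fin.Subset using (Subset; ∣_∣)
open import Function using (_∘_)
open import Function.Bundles using (_⇔_; mk⇔; Equivalence)
import Function.Properties.Equivalence as ⇔
open import Relation.Nullary using (¬_; yes; no; contradiction)
open import Relation.Binary.PropositionalEquality
open ≡-Reasoning

open Equivalence using (to; from)

∈-⊕⁺ : ∀ {X Y x y} → x ∈ X → y ∈ Y → x + y ∈ X ⊕ Y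
∈-⊕⁺ {X} {Y} {x} x∈X y∈Y =
  ∈-concatMap⁺ (λ x → map (x +_) Y) {xs = X} (Any.map (λ { refl → ∈-map⁺ (x +_) y∈Y }) x∈X)

∈-⊕⁻ : ∀ X Y {z} → z ∈ X ⊕ Y → ∃₂ λ x y → x ∈ X × y ∈ Y × z ≡ x + y
∈-⊕⁻ X Y z∈X⊕Y with x , x∈X , z∈x+Y ← find (∈-concatMap⁻ (λ x → map (x +_) Y) {xs = X} z∈X⊕Y)
                  with y , y∈Y , refl ← ∈-map⁻ (x +_) z∈x+Y = x , y , x∈X , y∈Y , refl

⊕-lowerBound : ∀ {b X Y z} → (∀ {x} → x ∈ X → b ≤ x) → z ∈ X ⊕ Y → b ≤ z
⊕-lowerBound {X = X} {Y} b≤X z∈X⊕Y with x , y , x∈X , _ , refl ← ∈-⊕⁻ X Y z∈X⊕Y =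
  ≤-trans (b≤X x∈X) (m≤m+n x y)

≋-via : ∀ {X Y} (P : ℕ → Set) → (∀ t → t ∈ X ⇔ P t) → (∀ t → t ∈ Y ⇔ P t) → X ≋ Y
≋-via P X⇔P Y⇔P t = ⇔.trans (X⇔P t) (⇔.sym (Y⇔P t))

map-≋ : ∀ f {X Y} → X ≋ Y → map f X ≋ map f Y
map-≋ f X≋Y t = mk⇔ (map-⊆ f (to (X≋Y _))) (map-⊆ f (from (X≋Y _)))

Isolated : ℕ → List ℕ → ℕ → Set
Isolated a Y y = y ∈ Y × a + y ∉ Y × (∀ {z} → z ∈ Y → a + z ≢ y)

isolated⇒¬Divides : ∀ H {a Y y} → Isolated a Y y → ¬ Divides H (0 ∷ a ∷ []) Y
isolated⇒¬Divides H {a} (y∈Y , a+y∉Y , y∉a+Y) (Z , _ , Y≋A⊕Z)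
  with ∈-⊕⁻ (0 ∷ a ∷ []) Z (to (Y≋A⊕Z _) y∈Y)
... | _ , z , here refl , z∈Z , refl =
  a+y∉Y (from (Y≋A⊕Z _) (∈-⊕⁺ {0 ∷ a ∷ []} (there (here refl)) z∈Z))
... | _ , z , there (here refl) , z∈Z , refl =
  y∉a+Y (from (Y≋A⊕Z _) (∈-⊕⁺ {0 ∷ a ∷ []} (here refl) z∈Z)) refl

Isolated-++ : ∀ {Y Y′ t} → Isolated 1 Y t → (∀ {z} → z ∈ Y′ → 2 + t ≤ z) →
              Isolated 1 (Y ++ Y′) t
Isolated-++ {Y} (t∈Y , 1+t∉Y , t∉1+Y) Y′≥2+t =
  ∈-++⁺ˡ t∈Y , 1+t∉Y++Y′ , t∉1+Y++Y′
  where
  1+t∉Y++Y′ : 1 + _ ∉ Y ++ _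
  1+t∉Y++Y′ p with ∈-++⁻ Y p
  ... | inj₁ p∈Y  = 1+t∉Y p∈Y
  ... | inj₂ p∈Y′ = 1+n≰n (Y′≥2+t p∈Y′)
  t∉1+Y++Y′ : ∀ {z} → z ∈ Y ++ _ → 1 + z ≢ _
  t∉1+Y++Y′ z∈ with ∈-++⁻ Y z∈
  ... | inj₁ z∈Y  = t∉1+Y z∈Y
  ... | inj₂ z∈Y′ = λ { refl → 1+n≰n (m+n≤o⇒n≤o 2 (Y′≥2+t z∈Y′)) }

scale : ℕ → List ℕ → List ℕ
scale a = map (_* a)

scale-⊕ : ∀ a X Y → scale a (X ⊕ Y) ≡ scale a X ⊕ scale a Y
scale-⊕ a []      Y = refl
scale-⊕ a (x ∷ X) Y = begin
  scale a (map (x +_) Y ++ X ⊕ Y)             ≡⟨ map-++ (_* a) (map (x +_) Y) (X ⊕ Y) ⟩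
  scale a (map (x +_) Y) ++ scale a (X ⊕ Y)   ≡⟨ cong₂ _++_ scale-shift (scale-⊕ a X Y) ⟩
  map (x * a +_) (scale a Y) ++ scale a X ⊕ scale a Y ∎
  where
  scale-shift : scale a (map (x +_) Y) ≡ map (x * a +_) (scale a Y)
  scale-shift = trans (sym (map-∘ Y)) (trans (map-cong (*-distribʳ-+ a x) Y) (map-∘ Y))

scale-sumFam : ∀ a {n} (X : Fin n → List ℕ) → sumFam (scale a ∘ X) ≡ scale a (sumFam X)
scale-sumFam a {zero}  X = refl
scale-sumFam a {suc n} X = trans (cong (scale a (X Fin.zero) ⊕_) (scale-sumFam a (X ∘ Fin.suc)))
                                 (sym (scale-⊕ a (X Fin.zero) _))

scale-sumSub : ∀ a {n} (Ω : Subset n) (X : Fin n → List ℕ) →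
               sumSub Ω (scale a ∘ X) ≡ scale a (sumSub Ω X)
scale-sumSub a []          X = refl
scale-sumSub a (true ∷ Ω)  X = trans (cong (scale a (X Fin.zero) ⊕_) (scale-sumSub a Ω (X ∘ Fin.suc)))
                                     (sym (scale-⊕ a (X Fin.zero) _))
scale-sumSub a (false ∷ Ω) X = scale-sumSub a Ω (X ∘ Fin.suc)

scale-isolated : ∀ a .{{_ : NonZero a}} {Y t} → Isolated 1 Y t → Isolated a (scale a Y) (t * a)
scale-isolated a {Y} {t} (t∈Y , 1+t∉Y , t∉1+Y) = ∈-map⁺ (_* a) t∈Y , a+ta∉aY , ta∉a+aY
  where
  a+ta∉aY : a + t * a ∉ scale a Y
  a+ta∉aY p with u , u∈Y , eq ← ∈-map⁻ (_* a) p =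
    1+t∉Y (subst (_∈ Y) (*-cancelʳ-≡ u (suc t) a (sym eq)) u∈Y)
  ta∉a+aY : ∀ {z} → z ∈ scale a Y → a + z ≢ t * a
  ta∉a+aY z∈aY eq with u , u∈Y , refl ← ∈-map⁻ (_* a) z∈aY =
    t∉1+Y u∈Y (*-cancelʳ-≡ (suc u) t a eq)

scale-divides : ∀ H a {Y Z} → Y ≋ ((0 ∷ 1 ∷ []) ⊕ Z) → H (scale a Z) →
                Divides H (0 ∷ a ∷ []) (scale a Y)
scale-divides H a {Y} {Z} Y≋ HaZ =
  scale a Z , HaZ , λ t → subst (λ B → t ∈ scale a Y ⇔ t ∈ B) scale-A⊕Z (map-≋ (_* a) Y≋ t)
  where
  scale-A⊕Z : scale a ((0 ∷ 1 ∷ []) ⊕ Z) ≡ (0 ∷ a ∷ []) ⊕ scale a Z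
  scale-A⊕Z = trans (scale-⊕ a (0 ∷ 1 ∷ []) Z) (cong (λ b → (0 ∷ b ∷ []) ⊕ scale a Z) (*-identityˡ a))

nfold : ℕ → List ℕ → List ℕ
nfold n L = sumFam {n} (λ _ → L)

sumSub-const : ∀ {n} (Ω : Subset n) L → sumSub Ω (λ _ → L) ≡ nfold ∣ Ω ∣ L
sumSub-const []          L = refl
sumSub-const (true ∷ Ω)  L = cong (L ⊕_) (sumSub-const Ω L)
sumSub-const (false ∷ Ω) L = sumSub-const Ω L

0∈nfold : ∀ n {L} → 0 ∈ L → 0 ∈ nfold n L
0∈nfold zero    _   = here refl
0∈nfold (suc n) 0∈L = ∈-⊕⁺ 0∈L (0∈nfold n 0∈L)

X013 : List ℕ
X013 = 0 ∷ 1 ∷ 3 ∷ []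

0∈X013 : 0 ∈ X013
0∈X013 = here refl

1∈X013 : 1 ∈ X013
1∈X013 = there (here refl)

3∈X013 : 3 ∈ X013
3∈X013 = there (there (here refl))

nfold-X013⁻ : ∀ n {t} → t ∈ nfold n X013 → t ≤ 3 * n × suc t ≢ 3 * n
nfold-X013⁻ zero    (here refl) = z≤n , λ ()
nfold-X013⁻ (suc n) t∈ with x , c , x∈ , c∈ , refl ← ∈-⊕⁻ X013 (nfold n X013) t∈ rewrite *-suc 3 n =
  step x∈ (nfold-X013⁻ n c∈)
  where
  step : ∀ {x c} → x ∈ X013 → c ≤ 3 * n × suc c ≢ 3 * n →
         x + c ≤ 3 + 3 * n × suc (x + c) ≢ 3 + 3 * n
  step (here refl)                 (c≤ , _) =
    ≤-trans c≤ (m≤n+m _ 3) , <⇒≢ (s≤s (s≤s (≤-trans c≤ (n≤1+n _))))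
  step (there (here refl))         (c≤ , _) =
    s≤s (≤-trans c≤ (m≤n+m _ 2)) , <⇒≢ (s≤s (s≤s (s≤s c≤)))
  step (there (there (here refl))) (c≤ , 1+c≢3n) =
    s≤s (s≤s (s≤s c≤)) , 1+c≢3n ∘ cong (_∸ 3)

nfold-X013⁺ : ∀ n t → t ≤ 3 * n → suc t ≢ 3 * n → t ∈ nfold n X013
nfold-X013⁺ zero          zero    _  _  = here refl
nfold-X013⁺ (suc n)       0       _  _  = ∈-⊕⁺ 0∈X013 (0∈nfold n 0∈X013)
nfold-X013⁺ (suc n)       1       _  _  = ∈-⊕⁺ 1∈X013 (0∈nfold n 0∈X013)
nfold-X013⁺ (suc zero)    2       _  3≢3 = contradiction refl 3≢3
nfold-X013⁺ (suc (suc n)) 2       _  _  =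
  ∈-⊕⁺ 1∈X013 (∈-⊕⁺ 1∈X013 (0∈nfold n 0∈X013))
nfold-X013⁺ (suc n) (suc (suc (suc r))) t≤ t≢ =
  ∈-⊕⁺ 3∈X013 (nfold-X013⁺ n r (+-cancelˡ-≤ 3 r (3 * n) (≤-trans t≤ (≤-reflexive (*-suc 3 n))))
                              (λ eq → t≢ (trans (cong (3 +_) eq) (sym (*-suc 3 n)))))

∈-nfold-X013 : ∀ n t → t ∈ nfold n X013 ⇔ (t ≤ 3 * n × suc t ≢ 3 * n)
∈-nfold-X013 n t = mk⇔ (nfold-X013⁻ n) (λ (t≤ , t≢) → nfold-X013⁺ n t t≤ t≢)

nfold-X013-isolated : ∀ n → Isolated 1 (nfold n X013) (3 * n)
nfold-X013-isolated n =
  nfold-X013⁺ n (3 * n) ≤-refl 1+n≢n , 1+n≰n ∘ proj₁ ∘ nfold-X013⁻ n , proj₂ ∘ nfold-X013⁻ n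

W : ℕ → List ℕ
W M = 0 ∷ pred M ∷ M ∷ []

-- M − 1 fills the gap of D and (M − 1) + M the gap of M + D; 1 < M is what puts 0 in D.
∈-W⊕ : ∀ {M D} → 1 < M → (∀ c → c ∈ D ⇔ (c ≤ M × suc c ≢ M)) →
       ∀ t → t ∈ W M ⊕ D ⇔ t ≤ M + M
∈-W⊕ {M} {D} 1<M ∈D t = mk⇔ bounded (filled t)
  where
  W≤M : ∀ {w} → w ∈ W M → w ≤ M
  W≤M (here refl)                 = z≤n
  W≤M (there (here refl))         = pred[n]≤n
  W≤M (there (there (here refl))) = ≤-refl

  bounded : t ∈ W M ⊕ D → t ≤ M + M
  bounded t∈ with w , c , w∈ , c∈ , refl ← ∈-⊕⁻ (W M) D t∈ =
    +-mono-≤ (W≤M w∈) (proj₁ (to (∈D c) c∈))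

  filled : ∀ t → t ≤ M + M → t ∈ W M ⊕ D
  filled t t≤2M with t ≤? M
  filled t t≤2M | yes t≤M with suc t ≟ M
  ... | no  1+t≢M = ∈-⊕⁺ {W M} (here refl) (from (∈D t) (t≤M , 1+t≢M))
  ... | yes refl  = subst (_∈ W M ⊕ D) (+-identityʳ t)
                          (∈-⊕⁺ {W M} (there (here refl)) (from (∈D 0) (z≤n , >⇒≢ 1<M ∘ sym)))
  filled t t≤2M | no  t≰M with r , refl ← m≤n⇒∃[o]m+o≡n (<⇒≤ (≰⇒> t≰M)) with suc r ≟ M
  ... | no  1+r≢M = ∈-⊕⁺ {W M} (there (there (here refl)))
                         (from (∈D r) (+-cancelˡ-≤ M r M t≤2M , 1+r≢M))
  ... | yes refl  = subst (_∈ W M ⊕ D) (+-suc r r)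
                          (∈-⊕⁺ {W M} (there (here refl)) (from (∈D (suc r)) (≤-refl , 1+n≢n)))

∈-01⊕upTo : ∀ {n} → 0 < n → ∀ t → t ∈ (0 ∷ 1 ∷ []) ⊕ upTo n ⇔ t ≤ n
∈-01⊕upTo {n} 0<n t = mk⇔ bounded (filled t)
  where
  bounded : t ∈ (0 ∷ 1 ∷ []) ⊕ upTo n → t ≤ n
  bounded t∈ with ∈-⊕⁻ (0 ∷ 1 ∷ []) (upTo n) t∈
  ... | _ , u , here refl         , u∈ , refl = <⇒≤ (∈-upTo⁻ u∈)
  ... | _ , u , there (here refl) , u∈ , refl = ∈-upTo⁻ u∈
  filled : ∀ t → t ≤ n → t ∈ (0 ∷ 1 ∷ []) ⊕ upTo n
  filled zero    _   = ∈-⊕⁺ {0 ∷ 1 ∷ []} (here refl) (∈-upTo⁺ 0<n)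
  filled (suc u) u<n = ∈-⊕⁺ {0 ∷ 1 ∷ []} (there (here refl)) (∈-upTo⁺ u<n)

-- W M ⊕ D unfolds to map (0 +_) D ++ (pred M ∷ M ∷ []) ⊕ D.
W⊕nfold-X013-isolated : ∀ {M} j → 3 * suc j ≤ M → Isolated 1 (W M ⊕ nfold j X013) (3 * j)
W⊕nfold-X013-isolated {M} j 3[1+j]≤M =
  Isolated-++ (subst (λ Y → Isolated 1 Y (3 * j)) (sym (map-id _)) (nfold-X013-isolated j))
              (⊕-lowerBound {Y = nfold j X013} W′≥2+3j)
  where
  2+3j<M : 2 + 3 * j < M
  2+3j<M = ≤-trans (≤-reflexive (sym (*-suc 3 j))) 3[1+j]≤M
  W′≥2+3j : ∀ {w} → w ∈ pred M ∷ M ∷ [] → 2 + 3 * j ≤ w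
  W′≥2+3j (here refl)         = <⇒≤pred 2+3j<M
  W′≥2+3j (there (here refl)) = <⇒≤ 2+3j<M

family : ∀ k → Fin (suc k) → List ℕ
family k Fin.zero    = W (3 * k)
family k (Fin.suc _) = X013

0∈family : ∀ k i → 0 ∈ family k i
0∈family k Fin.zero    = here refl
0∈family k (Fin.suc _) = 0∈X013

family-sum≋ : ∀ k → let M = 3 * suc k in
              sumFam (family (suc k)) ≋ ((0 ∷ 1 ∷ []) ⊕ upTo (M + M))
family-sum≋ k = ≋-via (_≤ M + M) (∈-W⊕ 1<M (∈-nfold-X013 (suc k))) (∈-01⊕upTo (s≤s z≤n))
  where
  M = 3 * suc k
  1<M : 1 < M
  1<M = ≤-trans (n≤1+n 2) (*-monoʳ-≤ 3 (s≤s z≤n))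

proper-subfamily-isolated : ∀ k (Ω : Subset (suc k)) → ∣ Ω ∣ ≤ k →
                            ∃ λ t → Isolated 1 (sumSub Ω (family k)) t
proper-subfamily-isolated k (false ∷ Ω) _ =
  3 * ∣ Ω ∣ , subst (λ Y → Isolated 1 Y (3 * ∣ Ω ∣)) (sym (sumSub-const Ω X013))
                    (nfold-X013-isolated ∣ Ω ∣)
proper-subfamily-isolated k (true ∷ Ω) ∣Ω∣<k =
  3 * ∣ Ω ∣ , subst (λ Y → Isolated 1 (W (3 * k) ⊕ Y) (3 * ∣ Ω ∣)) (sym (sumSub-const Ω X013))
                    (W⊕nfold-X013-isolated ∣ Ω ∣ (*-monoʳ-≤ 3 ∣Ω∣<k))

scaled-family-sum-divides : ∀ H a N → (∀ {L} → 0 ∈ L → H (scale a L)) →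
                            Divides H (0 ∷ a ∷ []) (sumFam (scale a ∘ family (suc N)))
scaled-family-sum-divides H a N H-scale =
  subst (Divides H (0 ∷ a ∷ [])) (sym (scale-sumFam a (family (suc N))))
        (scale-divides H a (family-sum≋ N) (H-scale (∈-upTo⁺ (s≤s z≤n))))

omega-infinite : ∀ (H : List ℕ → Set) a .{{_ : NonZero a}} →
                 (∀ {L} → 0 ∈ L → H (scale a L)) → OmegaInfinite H (0 ∷ a ∷ [])
omega-infinite H a H-scale N bound
  with Ω , ∣Ω∣≤N , A∣sumΩ ← bound (2 + N) (scale a ∘ family (suc N)) (H-scale ∘ 0∈family (suc N))
                                  (scaled-family-sum-divides H a N H-scale)
  with t , isolated ← proper-subfamily-isolated (suc N) Ω (≤-trans ∣Ω∣≤N (n≤1+n N)) =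
  isolated⇒¬Divides H (scale-isolated a isolated)
                      (subst (Divides H (0 ∷ a ∷ [])) (scale-sumSub a Ω (family (suc N))) A∣sumΩ)

multiples∈ : ∀ {S} → IsNumericalMonoid S → ∀ {a} → S a → ∀ t → S (t * a)
multiples∈ S-monoid Sa zero    = IsNumericalMonoid.zero∈ S-monoid
multiples∈ S-monoid Sa (suc t) = IsNumericalMonoid.+-closed S-monoid Sa (multiples∈ S-monoid Sa t)

theorem5p1 : (S : ℕ → Set) → IsNumericalMonoid S → (a : ℕ) → S a → ¬ (a ≡ 0) →
    OmegaInfinite (Pfin S) (0 ∷ a ∷ []) × OmegaInfinite (Pfin0 S) (0 ∷ a ∷ [])
theorem5p1 S S-monoid a Sa a≢0 =
  omega-infinite (Pfin S)  a {{a≠0}} (λ 0∈L → (0 , 0∈scale 0∈L) , scale⊆S) ,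
  omega-infinite (Pfin0 S) a {{a≠0}} (λ 0∈L → 0∈scale 0∈L , scale⊆S)
  where
  a≠0 : NonZero a
  a≠0 = ≢-nonZero a≢0
  0∈scale : ∀ {L} → 0 ∈ L → 0 ∈ scale a L
  0∈scale = ∈-map⁺ (_* a)
  scale⊆S : ∀ {L} → All.All S (scale a L)
  scale⊆S {L} = All.map⁺ (All.universal (multiples∈ S-monoid Sa) L)
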